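{- (1) $\mathsf{alpha}$ is an equivalence relation (reflexive, symmetric and transitive) on the set of good quasiterms, and $\mathsf{alphaAbs}$ is an equivalence relation on the set of good quasiabstractions. (2) Let $\mathsf{alpha}'$, $\mathsf{alphaAbs}'$ be the predicates defined by the same mutual recursion as $\mathsf{alpha}$, $\mathsf{alphaAbs}$, except that the abstraction clause is replaced by $\mathsf{alphaAbs}'\,(\mathsf{qAbs}\,xs\,x\,X)\,(\mathsf{qAbs}\,xs'\,x'\,X')\iff xs=xs'\wedge\big(\forall y\notin\{x,x'\}.\ \mathsf{qFresh}\,xs\,y\,X\wedge\mathsf{qFresh}\,xs\,y\,X'\Longrightarrow \mathsf{alpha}'\,(X[y\wedge x]_{xs})\,(X'[y\wedge x']_{xs})\big)$. Then for all good quasiterms $X,X'$ we have $\mathsf{alpha}'\,X\,X'\iff\mathsf{alpha}\,X\,X'$, and for all good quasiabstractions $A,A'$ we have $\mathsf{alphaAbs}'\,A\,A'\iff\mathsf{alphaAbs}\,A\,A'$.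
   Context: Fix arbitrary types $\mathbf{var}$, $\mathbf{varsort}$, $\mathbf{opsym}$, $\mathbf{index}$, $\mathbf{bindex}$. Standing assumption: $|\mathbf{var}|$ is a regular infinite cardinal. For types $\alpha,\beta$, an $(\alpha,\beta)$-input is a partial function $f:\alpha\to\beta\ \mathsf{option}$; $\mathsf{dom}\,f=\{i\mid f\,i\neq\mathsf{None}\}$. For a unary predicate $P$ on $\beta$, $\uparrow P\,f$ means $P\,b$ holds whenever $f\,i=\mathsf{Some}\,b$; for a binary predicate $P$ on $\beta$, $\uparrow P\,f\,f'$ means that for every $i$, either $f\,i=f'\,i=\mathsf{None}$, or $f\,i=\mathsf{Some}\,b$ and $f'\,i=\mathsf{Some}\,b'$ with $P\,b\,b'$. Quasiterms $\mathbf{qterm}$ and quasiabstractions $\mathbf{qabs}$ are the mutually inductive free datatypes with constructors $\mathsf{qVar}\,xs\,x$ ($xs:\mathbf{varsort}$, $x:\mathbf{var}$), $\mathsf{qOp}\,\delta\,inp\,binp$ ($\delta:\mathbf{opsym}$, $inp$ an $(\mathbf{index},\mathbf{qterm})$-input, $binp$ a $(\mathbf{bindex},\mathbf{qabs})$-input) and $\mathsf{qAbs}\,xs\,x\,X$ ($X:\mathbf{qterm}$, binding $x$ of varsort $xs$ in $X$). Freshness: $\mathsf{qFresh}\,ys\,y\,(\mathsf{qVar}\,xs\,x)\iff(ys,y)\neq(xs,x)$; $\mathsf{qFresh}\,ys\,y\,(\mathsf{qOp}\,\delta\,inp\,binp)\iff\uparrow(\mathsf{qFresh}\,ys\,y)\,inp\wedge\uparrow(\mathsf{qFreshAbs}\,ys\,y)\,binp$;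 $\mathsf{qFreshAbs}\,ys\,y\,(\mathsf{qAbs}\,xs\,x\,X)\iff(ys,y)=(xs,x)\vee\mathsf{qFresh}\,ys\,y\,X$. Swapping $X[z_1\wedge z_2]_{zs}$ replaces everywhere in $X$ (free, bound and binding positions) each variable $z_1$ of varsort $zs$ by $z_2$ and each $z_2$ of varsort $zs$ by $z_1$, leaving other variables and variables of other varsorts unchanged (likewise for quasiabstractions). Alpha-equivalence is defined by mutual recursion: $\mathsf{alpha}\,(\mathsf{qVar}\,xs\,x)\,(\mathsf{qVar}\,xs'\,x')\iff xs=xs'\wedge x=x'$; $\mathsf{alpha}\,(\mathsf{qOp}\,\delta\,inp\,binp)\,(\mathsf{qOp}\,\delta'\,inp'\,binp')\iff\delta=\delta'\wedge\uparrow\mathsf{alpha}\,inp\,inp'\wedge\uparrow\mathsf{alphaAbs}\,binp\,binp'$; $\mathsf{alpha}$ is false between a $\mathsf{qVar}$ and a $\mathsf{qOp}$ quasiterm (in either order); $\mathsf{alphaAbs}\,(\mathsf{qAbs}\,xs\,x\,X)\,(\mathsf{qAbs}\,xs'\,x'\,X')\iff xs=xs'\wedge\big(\exists y\notin\{x,x'\}.\ \mathsf{qFresh}\,xs\,y\,X\wedge\mathsf{qFresh}\,xs\,y\,X'\wedge\mathsf{alpha}\,(X[y\wedge x]_{xs})\,(X'[y\wedge x']_{xs})\big)$. Goodness: $\mathsf{qGood}\,(\mathsf{qVar}\,xs\,x)$ holds; $\mathsf{qGood}\,(\mathsf{qOp}\,\delta\,inp\,binp)\iff\uparrow\mathsf{qGood}\,inp\wedge\uparrow\mathsf{qGoodAbs}\,binp\wedge|\mathsf{dom}\,inp|<|\mathbf{var}|\wedge|\mathsf{dom}\,binp|<|\mathbf{var}|$;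 $\mathsf{qGoodAbs}\,(\mathsf{qAbs}\,xs\,x\,X)\iff\mathsf{qGood}\,X$. -}

module Defs where

open import Level using (0ℓ)
open import Data.Nat using (ℕ)
open import Data.Maybe using (Maybe; just; nothing)
open import Data.Product using (Σ; ∃; ∃₂; _×_; _,_)
open import Data.Sum using (_⊎_)
open import Relation.Nullary using (¬_; yes; no)
open import Relation.Binary.PropositionalEquality using (_≡_; _≢_)
open import Relation.Binary.Definitions using (DecidableEquality)
open import Function.Bundles using (_↣_)

_≲_ : Set → Set → Set
A ≲ B = A ↣ B

_≺_ : Set → Set → Set
A ≺ B = (A ≲ B) × ¬ (B ≲ A)

Infinite : Set → Set
Infinite A = ℕ ≲ A

Regular : Set → Set₁
Regular A = (I : Set) (S : I → A → Set) → I ≺ A →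
            ((i : I) → Σ A (S i) ≺ A) →
            Σ A (λ a → ∃ λ i → S i a) ≺ A

Input : Set → Set → Set
Input α β = α → Maybe β

dom : {α β : Set} → Input α β → Set
dom {α} f = Σ α (λ i → f i ≢ nothing)

liftPred : {α β : Set} → (β → Set) → Input α β → Set
liftPred {α} P f = (i : α) (b : _) → f i ≡ just b → P b

liftRel : {α β : Set} → (β → β → Set) → Input α β → Input α β → Set
liftRel {α} P f f' = (i : α) →
  (f i ≡ nothing × f' i ≡ nothing) ⊎
  (∃₂ λ b b' → f i ≡ just b × f' i ≡ just b' × P b b')

-- Quasiterms, parameterized by the five types and decidable equality
-- on variables and varsorts (needed to compute swapping).

module Terms (var varsort opsym index bindex : Set)
             (_≟v_ : DecidableEquality var)
             (_≟s_ : DecidableEquality varsort) where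

  data QTerm : Set
  data QAbs : Set

  data QTerm where
    qVar : varsort → var → QTerm
    qOp  : opsym → Input index QTerm → Input bindex QAbs → QTerm

  data QAbs where
    qAbs : varsort → var → QTerm → QAbs

  data qFresh (ys : varsort) (y : var) : QTerm → Set
  data qFreshAbs (ys : varsort) (y : var) : QAbs → Set

  data qFresh ys y where
    freshVar : ∀ {xs x} → ¬ ((ys , y) ≡ (xs , x)) → qFresh ys y (qVar xs x)
    freshOp  : ∀ {δ inp binp} → liftPred (qFresh ys y) inp →
               liftPred (qFreshAbs ys y) binp → qFresh ys y (qOp δ inp binp)

  data qFreshAbs ys y where
    freshAbs : ∀ {xs x X} → ((ys , y) ≡ (xs , x)) ⊎ qFresh ys y X →
               qFreshAbs ys y (qAbs xs x X)

  swapVar : varsort → var → var → varsort → var → var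
  swapVar zs z1 z2 xs x with xs ≟s zs
  ... | no _ = x
  ... | yes _ with x ≟v z1
  ...   | yes _ = z2
  ...   | no _ with x ≟v z2
  ...     | yes _ = z1
  ...     | no _ = x

  qSwap : QTerm → var → var → varsort → QTerm
  qSwapAbs : QAbs → var → var → varsort → QAbs
  qSwapM : Maybe QTerm → var → var → varsort → Maybe QTerm
  qSwapAbsM : Maybe QAbs → var → var → varsort → Maybe QAbs

  qSwap (qVar xs x) z1 z2 zs = qVar xs (swapVar zs z1 z2 xs x)
  qSwap (qOp δ inp binp) z1 z2 zs =
    qOp δ (λ i → qSwapM (inp i) z1 z2 zs) (λ i → qSwapAbsM (binp i) z1 z2 zs)
  qSwapAbs (qAbs xs x X) z1 z2 zs = qAbs xs (swapVar zs z1 z2 xs x) (qSwap X z1 z2 zs)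
  qSwapM nothing z1 z2 zs = nothing
  qSwapM (just X) z1 z2 zs = just (qSwap X z1 z2 zs)
  qSwapAbsM nothing z1 z2 zs = nothing
  qSwapAbsM (just A) z1 z2 zs = just (qSwapAbs A z1 z2 zs)

  _[_∧_]_ : QTerm → var → var → varsort → QTerm
  X [ z1 ∧ z2 ] zs = qSwap X z1 z2 zs

  data alpha : QTerm → QTerm → Set
  data alphaAbs : QAbs → QAbs → Set

  data alpha where
    alphaVar : ∀ {xs x xs' x'} → xs ≡ xs' → x ≡ x' → alpha (qVar xs x) (qVar xs' x')
    alphaOp  : ∀ {δ inp binp δ' inp' binp'} → δ ≡ δ' → liftRel alpha inp inp' →
               liftRel alphaAbs binp binp' → alpha (qOp δ inp binp) (qOp δ' inp' binp')

  data alphaAbs where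
    alphaAbsI : ∀ {xs x X xs' x' X'} → xs ≡ xs' →
                (∃ λ y → y ≢ x × y ≢ x' × qFresh xs y X × qFresh xs y X' ×
                         alpha (X [ y ∧ x ] xs) (X' [ y ∧ x' ] xs)) →
                alphaAbs (qAbs xs x X) (qAbs xs' x' X')

  data alpha' : QTerm → QTerm → Set
  data alphaAbs' : QAbs → QAbs → Set

  data alpha' where
    alpha'Var : ∀ {xs x xs' x'} → xs ≡ xs' → x ≡ x' → alpha' (qVar xs x) (qVar xs' x')
    alpha'Op  : ∀ {δ inp binp δ' inp' binp'} → δ ≡ δ' → liftRel alpha' inp inp' →
                liftRel alphaAbs' binp binp' → alpha' (qOp δ inp binp) (qOp δ' inp' binp')

  data alphaAbs' where
    alphaAbs'I : ∀ {xs x X xs' x' X'} → xs ≡ xs' →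
                 (∀ y → y ≢ x → y ≢ x' → qFresh xs y X → qFresh xs y X' →
                        alpha' (X [ y ∧ x ] xs) (X' [ y ∧ x' ] xs)) →
                 alphaAbs' (qAbs xs x X) (qAbs xs' x' X')

  data qGood : QTerm → Set
  data qGoodAbs : QAbs → Set

  data qGood where
    goodVar : ∀ {xs x} → qGood (qVar xs x)
    goodOp  : ∀ {δ inp binp} → liftPred qGood inp → liftPred qGoodAbs binp →
              dom inp ≺ var → dom binp ≺ var → qGood (qOp δ inp binp)

  data qGoodAbs where
    goodAbs : ∀ {xs x X} → qGood X → qGoodAbs (qAbs xs x X)

{-# OPTIONS --safe #-}
-- Everything reduces to renaming bound variables to fresh ones. Goodness (fewer than |var|
-- children at every node, |var| regular) makes the set of variables not fresh for a good term
-- small, so finitely many good terms always share a fresh variable (classically). Swapping two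
-- variables that are fresh for a term yields an alpha-equivalent term, hence the witness of an
-- alphaAbs can be replaced by any fresh variable. Reflexivity picks a fresh witness, transitivity
-- renames both witnesses to a common fresh one, and the same renaming shows that alpha satisfies
-- the universal clause of alpha'; conversely alpha' is instantiated at a fresh variable. Since the
-- inductions must reach swapped bodies of abstractions, properties are proved for all iterated
-- swaps of a term at once.
module Submission where

open import Defs
open import Level using (0ℓ)
open import Axiom.ExcludedMiddle using (ExcludedMiddle)
open import Data.Bool using (Bool; true; false; T; _∨_)
open import Data.Bool.Properties using (T-∨; T-irrelevant)
open import Data.Empty using (⊥; ⊥-elim)
open import Data.Unit using (⊤; tt)
open import Data.List using (List; []; _∷_)
open import Data.List.Relation.Unary.All as All using (All; []; _∷_)
open import Data.List.Relation.Unary.All.Properties using (map⁺; map⁻)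
open import Data.Maybe as Maybe using (Maybe; just; nothing)
open import Data.Maybe.Properties using (just-injective; map-id; map-∘)
open import Data.Nat using (ℕ)
open import Data.Product using (Σ; ∃; ∃₂; _×_; _,_; proj₁; proj₂)
open import Data.Sum using (_⊎_; inj₁; inj₂; [_,_])
open import Function using (_∘_; id; flip; case_of_)
open import Function.Bundles using (_⇔_; mk⇔; _↣_; Injection; mk↣; Equivalence)
open import Function.Construct.Composition using (_↣-∘_)
open import Relation.Nullary using (¬_; yes; no; Dec)
open import Relation.Nullary.Decidable
  using (isYes; isNo; T?; decidable-stable; toWitness; fromWitness; toWitnessFalse; fromWitnessFalse)
open import Relation.Binary.PropositionalEquality hiding ([_])
open import Relation.Binary.Definitions using (DecidableEquality)
open import Relation.Binary.Structures using (IsEquivalence)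

IsMaybeMap : {β γ : Set} → (Maybe β → Maybe γ) → (β → γ) → Set
IsMaybeMap F f = ∀ m → F m ≡ Maybe.map f m

nothing≢just : {β : Set} {b : β} → nothing ≢ just b
nothing≢just ()

liftRelAt : {β : Set} → (β → β → Set) → Maybe β → Maybe β → Set
liftRelAt R m m' = (m ≡ nothing × m' ≡ nothing) ⊎ (∃₂ λ b b' → m ≡ just b × m' ≡ just b' × R b b')

map-≡-just : {β γ : Set} {f : β → γ} (m : Maybe β) {c : γ} → Maybe.map f m ≡ just c → ∃ λ b → m ≡ just b × f b ≡ c
map-≡-just (just b) refl = b , refl , refl

module _ {α β : Set} where

  liftRel-diag : {R : β → β → Set} {f : Input α β} → liftPred (λ b → R b b) f → liftRel R f f
  liftRel-diag {f = f} p i with f i in eq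
  ... | nothing = inj₁ (refl , refl)
  ... | just b  = inj₂ (b , b , refl , refl , p i b eq)

  liftRel-map : {R S : β → β → Set} {f g : Input α β} →
                (∀ {b b'} → R b b' → S b b') → liftRel R f g → liftRel S f g
  liftRel-map h p i with p i
  ... | inj₁ none                   = inj₁ none
  ... | inj₂ (b , b' , e , e' , r) = inj₂ (b , b' , e , e' , h r)

  liftRel-sym : {R : β → β → Set} {f g : Input α β} → liftRel R f g → liftRel (flip R) g f
  liftRel-sym p i with p i
  ... | inj₁ (e , e')               = inj₁ (e' , e)
  ... | inj₂ (b , b' , e , e' , r) = inj₂ (b' , b , e' , e , r)

  liftRel-zip : {P Q : β → Set} {R : β → β → Set} {f g : Input α β} →
                liftPred P f → liftPred Q g → liftRel R f g → liftRel (λ a b → P a × Q b × R a b) f g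
  liftRel-zip p q r i with r i
  ... | inj₁ none                    = inj₁ none
  ... | inj₂ (b , b' , e , e' , rb) = inj₂ (b , b' , e , e' , p i b e , q i b' e' , rb)

  liftRel-zipˡ : {P : β → Set} {R : β → β → Set} {f g : Input α β} →
                 liftPred P f → liftRel R f g → liftRel (λ a b → P a × R a b) f g
  liftRel-zipˡ p r = liftRel-map (λ (pa , _ , rab) → pa , rab) (liftRel-zip {Q = λ _ → ⊤} p (λ _ _ _ → tt) r)

  liftRel-trans : {R S U : β → β → Set} {f g h : Input α β} →
                  (∀ {a b c} → R a b → S b c → U a c) → liftRel R f g → liftRel S g h → liftRel U f h
  liftRel-trans k p q i with p i | q i
  ... | inj₁ (e₁ , _) | inj₁ (_ , e₄) = inj₁ (e₁ , e₄)
  ... | inj₁ (_ , e₂) | inj₂ (_ , _ , e₃ , _ , _) = ⊥-elim (nothing≢just (trans (sym e₂) e₃))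
  ... | inj₂ (_ , _ , _ , e₂ , _) | inj₁ (e₃ , _) = ⊥-elim (nothing≢just (trans (sym e₃) e₂))
  ... | inj₂ (b , b' , e₁ , e₂ , r) | inj₂ (c , c' , e₃ , e₄ , s) with just-injective (trans (sym e₂) e₃)
  ...   | refl = inj₂ (b , c' , e₁ , e₄ , k r s)

  liftPred-transport : {P Q : β → Set} {R : β → β → Set} {f g : Input α β} →
                       (∀ {a b} → R a b → P a → Q b) → liftRel R f g → liftPred P f → liftPred Q g
  liftPred-transport k r p i c e with r i
  ... | inj₁ (_ , e') = ⊥-elim (nothing≢just (trans (sym e') e))
  ... | inj₂ (b , b' , e₁ , e₂ , rb) with just-injective (trans (sym e₂) e)
  ...   | refl = k rb (p i b e₁)

  liftRel-resp : {E R : β → β → Set} {f g f' g' : Input α β} →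
                 liftRel (λ a b → ∀ {a' b'} → E a a' → E b b' → R a' b') f g →
                 liftRel E f f' → liftRel E g g' → liftRel R f' g'
  liftRel-resp {E} {R} p e e' =
    liftRel-trans {R = flip E} {S = λ a b' → ∀ {a'} → E a a' → R a' b'} (λ a≈ h → h a≈) (liftRel-sym e)
      (liftRel-trans (λ h b≈ {_} a≈ → h a≈ b≈) p e')

  ¬liftPred⇒∃ : ExcludedMiddle 0ℓ → {P : β → Set} {f : Input α β} →
                ¬ liftPred P f → ∃₂ λ i b → f i ≡ just b × ¬ P b
  ¬liftPred⇒∃ em ¬p = decidable-stable em λ ∄ →
    ¬p λ i b e → decidable-stable em λ ¬pb → ∄ (i , b , e , ¬pb)

module _ {α β γ : Set} {F G : Maybe β → Maybe γ} {f' g' : β → γ} where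

  liftRel-mapInputs : {R : β → β → Set} {S : γ → γ → Set} {f g : Input α β} →
                      IsMaybeMap F f' → IsMaybeMap G g' →
                      (∀ {b b'} → R b b' → S (f' b) (g' b')) → liftRel R f g → liftRel S (F ∘ f) (G ∘ g)
  liftRel-mapInputs {f = f} {g} F≗ G≗ h p i rewrite F≗ (f i) | G≗ (g i) with p i
  ... | inj₁ (e , e') rewrite e | e' = inj₁ (refl , refl)
  ... | inj₂ (b , b' , e , e' , r) rewrite e | e' = inj₂ (_ , _ , refl , refl , h r)

  liftPred⇒liftRel-mapInputs : {P : β → Set} {S : γ → γ → Set} {f : Input α β} →
                               IsMaybeMap F f' → IsMaybeMap G g' →
                               (∀ {b} → P b → S (f' b) (g' b)) → liftPred P f → liftRel S (F ∘ f) (G ∘ f)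
  liftPred⇒liftRel-mapInputs {P = P} F≗ G≗ h p =
    liftRel-mapInputs {R = λ a b → P a × a ≡ b} F≗ G≗ (λ { (pb , refl) → h pb }) (liftRel-diag (λ i b e → p i b e , refl))

liftPred-mapInput : {α β γ : Set} {F : Maybe β → Maybe γ} {f' : β → γ} {Q : γ → Set} {f : Input α β} →
                    IsMaybeMap F f' → liftPred (Q ∘ f') f → liftPred Q (F ∘ f)
liftPred-mapInput {f = f} F≗ p i c e with f i in eq | trans (sym (F≗ (f i))) e
... | just b | refl = p i b eq

≺-resp-↣ : {A B C : Set} → B ↣ C → C ≺ A → B ≺ A
≺-resp-↣ k (l , ¬m) = l ↣-∘ k , λ m → ¬m (k ↣-∘ m)

bool-pigeonhole : (a b c : Bool) → a ≡ b ⊎ a ≡ c ⊎ b ≡ c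
bool-pigeonhole false false _     = inj₁ refl
bool-pigeonhole true  true  _     = inj₁ refl
bool-pigeonhole false true  false = inj₂ (inj₁ refl)
bool-pigeonhole false true  true  = inj₂ (inj₂ refl)
bool-pigeonhole true  false false = inj₂ (inj₂ refl)
bool-pigeonhole true  false true  = inj₂ (inj₁ refl)

module Smallness {A : Set} (_≟_ : DecidableEquality A) (inf : Infinite A) (reg : Regular A) where

  Small : (A → Bool) → Set
  Small p = Σ A (T ∘ p) ≺ A

  Σ-T-≡ : {p : A → Bool} {y y' : A} {t : T (p y)} {t' : T (p y')} → y ≡ y' → _≡_ {A = Σ A (T ∘ p)} (y , t) (y' , t')
  Σ-T-≡ {p} {y} refl = cong (y ,_) (T-irrelevant _ _)

  small-covered : {p : A → Bool} (S : A → Set) → (∀ y → T (p y) → S y) → Σ A S ≺ A → Small p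
  small-covered S cover = ≺-resp-↣ (mk↣ {to = λ (y , t) → y , cover y t} (Σ-T-≡ ∘ cong proj₁))

  small-⊆ : {p q : A → Bool} → (∀ y → T (p y) → T (q y)) → Small q → Small p
  small-⊆ {q = q} = small-covered (T ∘ q)

  ι : ℕ → A
  ι = Injection.to inf

  Bool≺ : Bool ≺ A
  Bool≺ = mk↣ {to = embed} embed-injective , ¬A↣Bool
    where
    embed : Bool → A
    embed true  = ι 0
    embed false = ι 1
    embed-injective : ∀ {b b'} → embed b ≡ embed b' → b ≡ b'
    embed-injective {true}  {true}  _ = refl
    embed-injective {false} {false} _ = refl
    embed-injective {true}  {false} e with Injection.injective inf e
    ... | ()
    embed-injective {false} {true}  e with Injection.injective inf e
    ... | ()
    ¬A↣Bool : ¬ (A ↣ Bool)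
    ¬A↣Bool k = [ collide {0} {1} (λ ()) , [ collide {0} {2} (λ ()) , collide {1} {2} (λ ()) ] ]
                  (bool-pigeonhole (κ 0) (κ 1) (κ 2))
      where
      κ : ℕ → Bool
      κ = Injection.to k ∘ ι
      collide : ∀ {m n} → m ≢ n → κ m ≡ κ n → ⊥
      collide m≢n = m≢n ∘ Injection.injective inf ∘ Injection.injective k

  small-∪ : {p q : A → Bool} → Small p → Small q → Small (λ y → p y ∨ q y)
  small-∪ {p} {q} sp sq = small-covered (λ y → ∃ λ b → S b y) cover (reg Bool S Bool≺ pieces)
    where
    S : Bool → A → Set
    S true  = T ∘ p
    S false = T ∘ q
    pieces : ∀ b → Σ A (S b) ≺ A
    pieces true  = sp
    pieces false = sq
    cover : ∀ y → T (p y ∨ q y) → ∃ λ b → S b y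
    cover y t with Equivalence.to T-∨ t
    ... | inj₁ tp = true , tp
    ... | inj₂ tq = false , tq

  small-singleton : ∀ x → Small (λ y → isYes (y ≟ x))
  small-singleton x = mk↣ {to = proj₁} Σ-T-≡ , ¬A↣singleton
    where
    ¬A↣singleton : ¬ (A ↣ Σ A (λ y → T (isYes (y ≟ x))))
    ¬A↣singleton k with Injection.injective inf (Injection.injective k (Σ-T-≡ (trans (at 0) (sym (at 1)))))
      where at : ∀ n → proj₁ (Injection.to k (ι n)) ≡ x
            at n = toWitness (proj₂ (Injection.to k (ι n)))
    ... | ()

  small-∅ : Small (λ _ → false)
  small-∅ = small-⊆ (λ _ ()) (small-singleton (ι 0))

  small-preimage : {p : A → Bool} (π : A → A) → (∀ {y y'} → π y ≡ π y' → y ≡ y') → Small p → Small (p ∘ π)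
  small-preimage π π-injective = ≺-resp-↣ (mk↣ {to = λ (y , t) → π y , t} (Σ-T-≡ ∘ π-injective ∘ cong proj₁))

  small⇒∃∉ : ExcludedMiddle 0ℓ → {p : A → Bool} → Small p → ∃ λ y → ¬ T (p y)
  small⇒∃∉ em {p} (_ , ¬A↣p) = decidable-stable em λ ∄ →
    ¬A↣p (mk↣ {to = λ y → y , decidable-stable (T? (p y)) (λ ¬t → ∄ (y , ¬t))} (cong proj₁))

  ⋁ : List (A → Bool) → A → Bool
  ⋁ []       y = false
  ⋁ (p ∷ ps) y = p y ∨ ⋁ ps y

  small-⋁ : {ps : List (A → Bool)} → All Small ps → Small (⋁ ps)
  small-⋁ []         = small-∅
  small-⋁ (sp ∷ sps) = small-∪ sp (small-⋁ sps)

  ∉-⋁ : ∀ ps {y} → ¬ T (⋁ ps y) → All (λ p → ¬ T (p y)) ps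
  ∉-⋁ []       _ = []
  ∉-⋁ (p ∷ ps) ∉ = ∉ ∘ Equivalence.from T-∨ ∘ inj₁ ∷ ∉-⋁ ps (∉ ∘ Equivalence.from T-∨ ∘ inj₂)

module Quasiterms (var varsort opsym index bindex : Set)
                  (_≟v_ : DecidableEquality var) (_≟s_ : DecidableEquality varsort) where

  open Terms var varsort opsym index bindex _≟v_ _≟s_

  swapVar-≢sort : ∀ {zs z₁ z₂ xs x} → xs ≢ zs → swapVar zs z₁ z₂ xs x ≡ x
  swapVar-≢sort {zs} {xs = xs} xs≢zs with xs ≟s zs
  ... | no _       = refl
  ... | yes xs≡zs = ⊥-elim (xs≢zs xs≡zs)

  swapVar-left : ∀ zs z₁ z₂ → swapVar zs z₁ z₂ zs z₁ ≡ z₂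
  swapVar-left zs z₁ z₂ with zs ≟s zs
  ... | no zs≢zs = ⊥-elim (zs≢zs refl)
  ... | yes _ with z₁ ≟v z₁
  ...   | yes _      = refl
  ...   | no z₁≢z₁ = ⊥-elim (z₁≢z₁ refl)

  swapVar-right : ∀ zs z₁ z₂ → swapVar zs z₁ z₂ zs z₂ ≡ z₁
  swapVar-right zs z₁ z₂ with zs ≟s zs
  ... | no zs≢zs = ⊥-elim (zs≢zs refl)
  ... | yes _ with z₂ ≟v z₁
  ...   | yes z₂≡z₁ = z₂≡z₁
  ...   | no _ with z₂ ≟v z₂
  ...     | yes _      = refl
  ...     | no z₂≢z₂ = ⊥-elim (z₂≢z₂ refl)

  swapVar-id : ∀ {zs z₁ z₂ xs x} → x ≢ z₁ → x ≢ z₂ → swapVar zs z₁ z₂ xs x ≡ x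
  swapVar-id {zs} {z₁} {z₂} {xs} {x} x≢z₁ x≢z₂ with xs ≟s zs
  ... | no _ = refl
  ... | yes _ with x ≟v z₁
  ...   | yes x≡z₁ = ⊥-elim (x≢z₁ x≡z₁)
  ...   | no _ with x ≟v z₂
  ...     | yes x≡z₂ = ⊥-elim (x≢z₂ x≡z₂)
  ...     | no _      = refl

  swapVar-involutive : ∀ zs z₁ z₂ xs x → swapVar zs z₁ z₂ xs (swapVar zs z₁ z₂ xs x) ≡ x
  swapVar-involutive zs z₁ z₂ xs x = by-cases (xs ≟s zs) (x ≟v z₁) (x ≟v z₂)
    where
    by-cases : Dec (xs ≡ zs) → Dec (x ≡ z₁) → Dec (x ≡ z₂) →
               swapVar zs z₁ z₂ xs (swapVar zs z₁ z₂ xs x) ≡ x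
    by-cases (no xs≢zs) _ _ = trans (swapVar-≢sort xs≢zs) (swapVar-≢sort xs≢zs)
    by-cases (yes refl) (yes refl) _ = trans (cong (swapVar zs x z₂ zs) (swapVar-left zs x z₂)) (swapVar-right zs x z₂)
    by-cases (yes refl) (no _) (yes refl) = trans (cong (swapVar zs z₁ x zs) (swapVar-right zs z₁ x)) (swapVar-left zs z₁ x)
    by-cases (yes refl) (no x≢z₁) (no x≢z₂) =
      trans (cong (swapVar zs z₁ z₂ zs) (swapVar-id x≢z₁ x≢z₂)) (swapVar-id x≢z₁ x≢z₂)

  swapVar-injective : ∀ {zs z₁ z₂ xs x x'} → swapVar zs z₁ z₂ xs x ≡ swapVar zs z₁ z₂ xs x' → x ≡ x'
  swapVar-injective {zs} {z₁} {z₂} {xs} {x} {x'} e = begin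
    x                                            ≡⟨ swapVar-involutive zs z₁ z₂ xs x ⟨
    swapVar zs z₁ z₂ xs (swapVar zs z₁ z₂ xs x)  ≡⟨ cong (swapVar zs z₁ z₂ xs) e ⟩
    swapVar zs z₁ z₂ xs (swapVar zs z₁ z₂ xs x') ≡⟨ swapVar-involutive zs z₁ z₂ xs x' ⟩
    x'                                           ∎
    where open ≡-Reasoning

  swapVar-conjugate : ∀ s a b t y x u z →
    swapVar s a b u (swapVar t y x u z) ≡ swapVar t (swapVar s a b t y) (swapVar s a b t x) u (swapVar s a b u z)
  swapVar-conjugate s a b t y x u z = by-cases (u ≟s t) (z ≟v y) (z ≟v x)
    where
    by-cases : Dec (u ≡ t) → Dec (z ≡ y) → Dec (z ≡ x) →
               swapVar s a b u (swapVar t y x u z) ≡ swapVar t (swapVar s a b t y) (swapVar s a b t x) u (swapVar s a b u z)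
    by-cases (no u≢t) _ _ = trans (cong (swapVar s a b u) (swapVar-≢sort u≢t)) (sym (swapVar-≢sort u≢t))
    by-cases (yes refl) (yes refl) _ = trans (cong (swapVar s a b u) (swapVar-left u z x)) (sym (swapVar-left u _ _))
    by-cases (yes refl) (no _) (yes refl) = trans (cong (swapVar s a b u) (swapVar-right u y z)) (sym (swapVar-right u _ _))
    by-cases (yes refl) (no z≢y) (no z≢x) = trans (cong (swapVar s a b u) (swapVar-id z≢y z≢x))
      (sym (swapVar-id (z≢y ∘ swapVar-injective) (z≢x ∘ swapVar-injective)))

  swapVar-fresh : ∀ {s a b xs x} → (s , a) ≢ (xs , x) → (s , b) ≢ (xs , x) → swapVar s a b xs x ≡ x
  swapVar-fresh {s} {a} {b} {xs} {x} a≢ b≢ = by-cases (xs ≟s s)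
    where
    by-cases : Dec (xs ≡ s) → swapVar s a b xs x ≡ x
    by-cases (no xs≢s)  = swapVar-≢sort xs≢s
    by-cases (yes refl) = swapVar-id (a≢ ∘ cong (xs ,_) ∘ sym) (b≢ ∘ cong (xs ,_) ∘ sym)

  swapVar-pair-injective : ∀ s a b {t z xs x} →
    (t , swapVar s a b t z) ≡ (xs , swapVar s a b xs x) → (t , z) ≡ (xs , x)
  swapVar-pair-injective s a b e with cong proj₁ e
  ... | refl = cong (_ ,_) (swapVar-injective (cong proj₂ e))

  module _ (P : QTerm → Set) (Pᴬ : QAbs → Set)
           (var-case : ∀ xs x → P (qVar xs x))
           (op-case : ∀ δ inp binp → liftPred P inp → liftPred Pᴬ binp → P (qOp δ inp binp))
           (abs-case : ∀ xs x X → P X → Pᴬ (qAbs xs x X)) where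

    quasiterm-ind : ∀ X → P X
    quasiabs-ind : ∀ A → Pᴬ A
    private
      quasiterm-indM : ∀ (m : Maybe QTerm) X → m ≡ just X → P X
      quasiabs-indM : ∀ (m : Maybe QAbs) A → m ≡ just A → Pᴬ A

    quasiterm-ind (qVar xs x) = var-case xs x
    quasiterm-ind (qOp δ inp binp) =
      op-case δ inp binp (λ i → quasiterm-indM (inp i)) (λ i → quasiabs-indM (binp i))
    quasiabs-ind (qAbs xs x X) = abs-case xs x X (quasiterm-ind X)
    quasiterm-indM (just X) .X refl = quasiterm-ind X
    quasiabs-indM (just A) .A refl = quasiabs-ind A

  body : QAbs → QTerm
  body (qAbs _ _ X) = X

  -- Pointwise equality of inputs: identifying two qOp terms propositionally would need
  -- function extensionality.
  infix 4 _≋_ _≋ᴬ_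
  data _≋_ : QTerm → QTerm → Set
  data _≋ᴬ_ : QAbs → QAbs → Set

  data _≋_ where
    ≋var : ∀ {xs x x'} → x ≡ x' → qVar xs x ≋ qVar xs x'
    ≋op  : ∀ {δ inp binp inp' binp'} → liftRel _≋_ inp inp' → liftRel _≋ᴬ_ binp binp' →
           qOp δ inp binp ≋ qOp δ inp' binp'

  data _≋ᴬ_ where
    ≋abs : ∀ {xs x x' X Y} → x ≡ x' → X ≋ Y → qAbs xs x X ≋ᴬ qAbs xs x' Y

  ≋-refl : ∀ X → X ≋ X
  ≋-refl = quasiterm-ind (λ X → X ≋ X) (λ A → A ≋ᴬ A) (λ _ _ → ≋var refl)
    (λ _ _ _ ih ihᴬ → ≋op (liftRel-diag ih) (liftRel-diag ihᴬ))
    (λ _ _ _ ih → ≋abs refl ih)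

  qSwapM-map : ∀ a b s → IsMaybeMap (λ m → qSwapM m a b s) (λ X → X [ a ∧ b ] s)
  qSwapM-map a b s nothing  = refl
  qSwapM-map a b s (just _) = refl

  qSwapAbsM-map : ∀ a b s → IsMaybeMap (λ m → qSwapAbsM m a b s) (λ A → qSwapAbs A a b s)
  qSwapAbsM-map a b s nothing  = refl
  qSwapAbsM-map a b s (just _) = refl

  qSwapM²-map : ∀ a b s a' b' s' →
    IsMaybeMap (λ m → qSwapM (qSwapM m a b s) a' b' s') (λ X → (X [ a ∧ b ] s) [ a' ∧ b' ] s')
  qSwapM²-map a b s a' b' s' nothing  = refl
  qSwapM²-map a b s a' b' s' (just _) = refl

  qSwapAbsM²-map : ∀ a b s a' b' s' →
    IsMaybeMap (λ m → qSwapAbsM (qSwapAbsM m a b s) a' b' s') (λ A → qSwapAbs (qSwapAbs A a b s) a' b' s')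
  qSwapAbsM²-map a b s a' b' s' nothing  = refl
  qSwapAbsM²-map a b s a' b' s' (just _) = refl

  id-map : {β : Set} → IsMaybeMap {β} id id
  id-map m = sym (map-id m)

  qSwap-cong : ∀ {X Y} a b s → X ≋ Y → X [ a ∧ b ] s ≋ Y [ a ∧ b ] s
  qSwap-cong {X} = quasiterm-ind
    (λ X → ∀ {Y} a b s → X ≋ Y → X [ a ∧ b ] s ≋ Y [ a ∧ b ] s)
    (λ A → ∀ {B} a b s → A ≋ᴬ B → qSwapAbs A a b s ≋ᴬ qSwapAbs B a b s)
    (λ { _ _ a b s (≋var refl) → ≋var refl })
    (λ { _ _ _ ih ihᴬ a b s (≋op r rᴬ) →
         ≋op (liftRel-mapInputs (qSwapM-map a b s) (qSwapM-map a b s) (λ (ihX , X≋Y) → ihX a b s X≋Y)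
                                (liftRel-zipˡ ih r))
             (liftRel-mapInputs (qSwapAbsM-map a b s) (qSwapAbsM-map a b s) (λ (ihA , A≋B) → ihA a b s A≋B)
                                (liftRel-zipˡ ihᴬ rᴬ)) })
    (λ { _ _ _ ih a b s (≋abs refl X≋Y) → ≋abs refl (ih a b s X≋Y) }) X

  qSwap-conjugate : ∀ X s a b t y x →
    (X [ y ∧ x ] t) [ a ∧ b ] s ≋ (X [ a ∧ b ] s) [ swapVar s a b t y ∧ swapVar s a b t x ] t
  qSwap-conjugate = quasiterm-ind
    (λ X → ∀ s a b t y x → (X [ y ∧ x ] t) [ a ∧ b ] s ≋ (X [ a ∧ b ] s) [ swapVar s a b t y ∧ swapVar s a b t x ] t)
    (λ A → ∀ s a b t y x → qSwapAbs (qSwapAbs A y x t) a b s ≋ᴬ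
                           qSwapAbs (qSwapAbs A a b s) (swapVar s a b t y) (swapVar s a b t x) t)
    (λ xs z s a b t y x → ≋var (swapVar-conjugate s a b t y x xs z))
    (λ _ _ _ ih ihᴬ s a b t y x →
      ≋op (liftPred⇒liftRel-mapInputs (qSwapM²-map y x t a b s) (qSwapM²-map a b s _ _ t)
                                      (λ ihX → ihX s a b t y x) ih)
          (liftPred⇒liftRel-mapInputs (qSwapAbsM²-map y x t a b s) (qSwapAbsM²-map a b s _ _ t)
                                      (λ ihA → ihA s a b t y x) ihᴬ))
    (λ xs z _ ih s a b t y x → ≋abs (swapVar-conjugate s a b t y x xs z) (ih s a b t y x))

  qFresh-resp-≋ : ∀ {s z X Y} → X ≋ Y → qFresh s z X → qFresh s z Y
  qFresh-resp-≋ {s} {z} {X} = quasiterm-ind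
    (λ X → ∀ {Y} → X ≋ Y → qFresh s z X → qFresh s z Y)
    (λ A → ∀ {B} → A ≋ᴬ B → qFreshAbs s z A → qFreshAbs s z B)
    (λ { _ _ (≋var refl) f → f })
    (λ { _ _ _ ih ihᴬ (≋op r rᴬ) (freshOp f fᴬ) →
         freshOp (liftPred-transport (λ (ihX , X≋Y) → ihX X≋Y) (liftRel-zipˡ ih r) f)
                 (liftPred-transport (λ (ihA , A≋B) → ihA A≋B) (liftRel-zipˡ ihᴬ rᴬ) fᴬ) })
    (λ { _ _ _ ih (≋abs refl X≋Y) (freshAbs (inj₁ e)) → freshAbs (inj₁ e)
       ; _ _ _ ih (≋abs refl X≋Y) (freshAbs (inj₂ f)) → freshAbs (inj₂ (ih X≋Y f)) }) X

  qFresh-swap : ∀ {t z} X a b s → qFresh t z X → qFresh t (swapVar s a b t z) (X [ a ∧ b ] s)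
  qFresh-swap {t} {z} X a b s = quasiterm-ind
    (λ X → ∀ {t z} → qFresh t z X → qFresh t (swapVar s a b t z) (X [ a ∧ b ] s))
    (λ A → ∀ {t z} → qFreshAbs t z A → qFreshAbs t (swapVar s a b t z) (qSwapAbs A a b s))
    (λ { _ _ (freshVar ≢) → freshVar (≢ ∘ swapVar-pair-injective s a b) })
    (λ { _ _ _ ih ihᴬ (freshOp f fᴬ) →
         freshOp (liftPred-mapInput (qSwapM-map a b s) (λ i X e → ih i X e (f i X e)))
                 (liftPred-mapInput (qSwapAbsM-map a b s) (λ i A e → ihᴬ i A e (fᴬ i A e))) })
    (λ { _ _ _ ih (freshAbs (inj₁ refl)) → freshAbs (inj₁ refl)
       ; _ _ _ ih (freshAbs (inj₂ f))    → freshAbs (inj₂ (ih f)) }) X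

  module AlphaInduction (P : QTerm → QTerm → Set) (Pᴬ : QAbs → QAbs → Set)
    (var-case : ∀ xs x → P (qVar xs x) (qVar xs x))
    (op-case : ∀ δ inp binp inp' binp' → liftRel P inp inp' → liftRel Pᴬ binp binp' →
               P (qOp δ inp binp) (qOp δ inp' binp'))
    (abs-case : ∀ xs x X x' X' y → y ≢ x → y ≢ x' → qFresh xs y X → qFresh xs y X' →
                P (X [ y ∧ x ] xs) (X' [ y ∧ x' ] xs) → Pᴬ (qAbs xs x X) (qAbs xs x' X')) where

    alpha-ind : ∀ {X Y} → alpha X Y → P X Y
    alphaAbs-ind : ∀ {A B} → alphaAbs A B → Pᴬ A B
    private
      alpha-indM : ∀ {m m' : Maybe QTerm} → liftRelAt alpha m m' → liftRelAt P m m'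
      alphaAbs-indM : ∀ {m m' : Maybe QAbs} → liftRelAt alphaAbs m m' → liftRelAt Pᴬ m m'

    alpha-ind (alphaVar refl refl) = var-case _ _
    alpha-ind (alphaOp refl r rᴬ) = op-case _ _ _ _ _ (alpha-indM ∘ r) (alphaAbs-indM ∘ rᴬ)
    alphaAbs-ind (alphaAbsI refl (y , y≢x , y≢x' , f , f' , r)) = abs-case _ _ _ _ _ y y≢x y≢x' f f' (alpha-ind r)
    alpha-indM (inj₁ none) = inj₁ none
    alpha-indM (inj₂ (X , Y , e , e' , r)) = inj₂ (X , Y , e , e' , alpha-ind r)
    alphaAbs-indM (inj₁ none) = inj₁ none
    alphaAbs-indM (inj₂ (A , B , e , e' , r)) = inj₂ (A , B , e , e' , alphaAbs-ind r)

  module Alpha'Induction (P : QTerm → QTerm → Set) (Pᴬ : QAbs → QAbs → Set)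
    (var-case : ∀ xs x → P (qVar xs x) (qVar xs x))
    (op-case : ∀ δ inp binp inp' binp' → liftRel P inp inp' → liftRel Pᴬ binp binp' →
               P (qOp δ inp binp) (qOp δ inp' binp'))
    (abs-case : ∀ xs x X x' X' → (∀ y → y ≢ x → y ≢ x' → qFresh xs y X → qFresh xs y X' →
                                  P (X [ y ∧ x ] xs) (X' [ y ∧ x' ] xs)) →
                Pᴬ (qAbs xs x X) (qAbs xs x' X')) where

    alpha'-ind : ∀ {X Y} → alpha' X Y → P X Y
    alphaAbs'-ind : ∀ {A B} → alphaAbs' A B → Pᴬ A B
    private
      alpha'-indM : ∀ {m m' : Maybe QTerm} → liftRelAt alpha' m m' → liftRelAt P m m'
      alphaAbs'-indM : ∀ {m m' : Maybe QAbs} → liftRelAt alphaAbs' m m' → liftRelAt Pᴬ m m'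

    alpha'-ind (alpha'Var refl refl) = var-case _ _
    alpha'-ind (alpha'Op refl r rᴬ) = op-case _ _ _ _ _ (alpha'-indM ∘ r) (alphaAbs'-indM ∘ rᴬ)
    alphaAbs'-ind (alphaAbs'I refl h) = abs-case _ _ _ _ _ λ y y≢x y≢x' f f' → alpha'-ind (h y y≢x y≢x' f f')
    alpha'-indM (inj₁ none) = inj₁ none
    alpha'-indM (inj₂ (X , Y , e , e' , r)) = inj₂ (X , Y , e , e' , alpha'-ind r)
    alphaAbs'-indM (inj₁ none) = inj₁ none
    alphaAbs'-indM (inj₂ (A , B , e , e' , r)) = inj₂ (A , B , e , e' , alphaAbs'-ind r)

  alpha-resp-≋ : ∀ {X Y X' Y'} → alpha X Y → X ≋ X' → Y ≋ Y' → alpha X' Y'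
  alpha-resp-≋ r = AlphaInduction.alpha-ind
    (λ X Y → ∀ {X' Y'} → X ≋ X' → Y ≋ Y' → alpha X' Y')
    (λ A B → ∀ {A' B'} → A ≋ᴬ A' → B ≋ᴬ B' → alphaAbs A' B')
    (λ { _ _ (≋var refl) (≋var refl) → alphaVar refl refl })
    (λ { _ _ _ _ _ r rᴬ (≋op e₁ eᴬ₁) (≋op e₂ eᴬ₂) →
         alphaOp refl (liftRel-resp r e₁ e₂) (liftRel-resp rᴬ eᴬ₁ eᴬ₂) })
    (λ { _ _ _ _ _ y y≢x y≢x' f f' r (≋abs refl X≋) (≋abs refl X'≋) →
         alphaAbsI refl (y , y≢x , y≢x' , qFresh-resp-≋ X≋ f , qFresh-resp-≋ X'≋ f' ,
                         r (qSwap-cong y _ _ X≋) (qSwap-cong y _ _ X'≋)) })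
    r

  alpha-sym : ∀ {X Y} → alpha X Y → alpha Y X
  alpha-sym r = AlphaInduction.alpha-ind (flip alpha) (flip alphaAbs) (λ _ _ → alphaVar refl refl)
    (λ _ _ _ _ _ r rᴬ → alphaOp refl (liftRel-sym r) (liftRel-sym rᴬ))
    (λ _ _ _ _ _ y y≢x y≢x' f f' r → alphaAbsI refl (y , y≢x' , y≢x , f' , f , r))
    r

  alphaAbs-sym : ∀ {A B} → alphaAbs A B → alphaAbs B A
  alphaAbs-sym (alphaAbsI refl (y , y≢x , y≢x' , f , f' , r)) = alphaAbsI refl (y , y≢x' , y≢x , f' , f , alpha-sym r)

  alpha-swap : ∀ {X Y} a b s → alpha X Y → alpha (X [ a ∧ b ] s) (Y [ a ∧ b ] s)
  alpha-swap a b s r = AlphaInduction.alpha-ind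
    (λ X Y → ∀ a b s → alpha (X [ a ∧ b ] s) (Y [ a ∧ b ] s))
    (λ A B → ∀ a b s → alphaAbs (qSwapAbs A a b s) (qSwapAbs B a b s))
    (λ _ _ _ _ _ → alphaVar refl refl)
    (λ _ _ _ _ _ r rᴬ a b s → alphaOp refl
      (liftRel-mapInputs (qSwapM-map a b s) (qSwapM-map a b s) (λ h → h a b s) r)
      (liftRel-mapInputs (qSwapAbsM-map a b s) (qSwapAbsM-map a b s) (λ h → h a b s) rᴬ))
    (λ xs x X x' X' y y≢x y≢x' f f' r a b s →
      alphaAbsI refl (swapVar s a b xs y , y≢x ∘ swapVar-injective , y≢x' ∘ swapVar-injective ,
                      qFresh-swap X a b s f , qFresh-swap X' a b s f' ,
                      alpha-resp-≋ (r a b s) (qSwap-conjugate X s a b xs y x) (qSwap-conjugate X' s a b xs y x')))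
    r a b s

  Swaps : Set
  Swaps = List (varsort × var × var)

  swaps : Swaps → QTerm → QTerm
  swaps []                X = X
  swaps ((s , a , b) ∷ σ) X = swaps σ X [ a ∧ b ] s

  swapsAbs : Swaps → QAbs → QAbs
  swapsAbs []                A = A
  swapsAbs ((s , a , b) ∷ σ) A = qSwapAbs (swapsAbs σ A) a b s

  swaps-qVar : ∀ σ xs x → ∃ λ x' → swaps σ (qVar xs x) ≡ qVar xs x'
  swaps-qVar [] xs x = x , refl
  swaps-qVar ((s , a , b) ∷ σ) xs x with swaps σ (qVar xs x) | swaps-qVar σ xs x
  ... | _ | x' , refl = swapVar s a b xs x' , refl

  swaps-qOp : ∀ σ δ inp binp → ∃₂ λ inp' binp' → swaps σ (qOp δ inp binp) ≡ qOp δ inp' binp' ×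
              (∀ i → inp' i ≡ Maybe.map (swaps σ) (inp i)) × (∀ i → binp' i ≡ Maybe.map (swapsAbs σ) (binp i))
  swaps-qOp [] δ inp binp = inp , binp , refl , sym ∘ map-id ∘ inp , sym ∘ map-id ∘ binp
  swaps-qOp ((s , a , b) ∷ σ) δ inp binp with swaps σ (qOp δ inp binp) | swaps-qOp σ δ inp binp
  ... | _ | inp' , binp' , refl , e , eᴬ =
    (λ i → qSwapM (inp' i) a b s) , (λ i → qSwapAbsM (binp' i) a b s) , refl ,
    (λ i → trans (qSwapM-map a b s (inp' i)) (trans (cong (Maybe.map _) (e i)) (sym (map-∘ (inp i))))) ,
    (λ i → trans (qSwapAbsM-map a b s (binp' i)) (trans (cong (Maybe.map _) (eᴬ i)) (sym (map-∘ (binp i)))))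

  body-swapsAbs : ∀ σ A → body (swapsAbs σ A) ≡ swaps σ (body A)
  body-swapsAbs [] A = refl
  body-swapsAbs ((s , a , b) ∷ σ) A with swapsAbs σ A | body-swapsAbs σ A
  ... | qAbs _ _ _ | e = cong (λ Z → Z [ a ∧ b ] s) e

  module _ (Q : QTerm → Set)
           (var-case : ∀ xs x → Q (qVar xs x))
           (op-case : ∀ δ inp binp → liftPred Q inp → liftPred (λ A → ∀ a b s → Q (body A [ a ∧ b ] s)) binp →
                      Q (qOp δ inp binp)) where

    swap-ind : ∀ X → Q X
    swap-ind X = quasiterm-ind (λ X → ∀ σ → Q (swaps σ X)) (λ A → ∀ σ → Q (swaps σ (body A)))
                               swaps-var swaps-op (λ _ _ _ ih → ih) X []
      where
      swaps-var : ∀ xs x σ → Q (swaps σ (qVar xs x))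
      swaps-var xs x σ with swaps σ (qVar xs x) | swaps-qVar σ xs x
      ... | _ | x' , refl = var-case xs x'

      swaps-op : ∀ δ inp binp → liftPred (λ X → ∀ σ → Q (swaps σ X)) inp →
                 liftPred (λ A → ∀ σ → Q (swaps σ (body A))) binp → ∀ σ → Q (swaps σ (qOp δ inp binp))
      swaps-op δ inp binp ih ihᴬ σ with swaps σ (qOp δ inp binp) | swaps-qOp σ δ inp binp
      ... | _ | inp' , binp' , refl , e , eᴬ = op-case δ inp' binp' children bodies
        where
        children : liftPred Q inp'
        children i Y e' with map-≡-just (inp i) (trans (sym (e i)) e')
        ... | X , eX , refl = ih i X eX σ
        bodies : liftPred (λ A → ∀ a b s → Q (body A [ a ∧ b ] s)) binp'
        bodies i A e' a b s with map-≡-just (binp i) (trans (sym (eᴬ i)) e')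
        ... | A₀ , eA , refl = subst Q (cong (λ Z → Z [ a ∧ b ] s) (sym (body-swapsAbs σ A₀)))
                                       (ihᴬ i A₀ eA ((s , a , b) ∷ σ))

module AlphaOnGood (var varsort opsym index bindex : Set)
                   (_≟v_ : DecidableEquality var) (_≟s_ : DecidableEquality varsort)
                   (em : ExcludedMiddle 0ℓ) (inf : Infinite var) (reg : Regular var) where

  open Terms var varsort opsym index bindex _≟v_ _≟s_
  open Quasiterms var varsort opsym index bindex _≟v_ _≟s_
  open Smallness _≟v_ inf reg

  nonFresh : varsort → QTerm → var → Bool
  nonFresh s X y = isNo (em {qFresh s y X})

  nonFresh⇒¬qFresh : ∀ {s X y} → T (nonFresh s X y) → ¬ qFresh s y X
  nonFresh⇒¬qFresh {s} {X} {y} = toWitnessFalse {a? = em {qFresh s y X}}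

  ¬qFresh⇒nonFresh : ∀ {s X y} → ¬ qFresh s y X → T (nonFresh s X y)
  ¬qFresh⇒nonFresh {s} {X} {y} = fromWitnessFalse {a? = em {qFresh s y X}}

  ∉nonFresh⇒qFresh : ∀ {s X y} → ¬ T (nonFresh s X y) → qFresh s y X
  ∉nonFresh⇒qFresh ∉ = decidable-stable em (∉ ∘ ¬qFresh⇒nonFresh)

  small-nonFresh-swap : ∀ {t X} a b s → Small (nonFresh t X) → Small (nonFresh t (X [ a ∧ b ] s))
  small-nonFresh-swap {t} {X} a b s small = small-⊆ moved (small-preimage (swapVar s a b t) swapVar-injective small)
    where
    moved : ∀ y → T (nonFresh t (X [ a ∧ b ] s) y) → T (nonFresh t X (swapVar s a b t y))
    moved y nf = ¬qFresh⇒nonFresh λ fX →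
      nonFresh⇒¬qFresh nf (subst (λ v → qFresh t v _) (swapVar-involutive s a b t y) (qFresh-swap X a b s fX))

  -- qGood is not visibly preserved by swapping (dom carries proofs of f i ≢ nothing, whose
  -- equality would need function extensionality); Supported keeps instead the consequence of
  -- goodness that matters, the smallness of the non-fresh variables of every operation node.
  data Supported : QTerm → Set
  data SupportedAbs : QAbs → Set

  data Supported where
    supVar : ∀ {xs x} → Supported (qVar xs x)
    supOp  : ∀ {δ inp binp} → liftPred Supported inp → liftPred SupportedAbs binp →
             (∀ s → Small (nonFresh s (qOp δ inp binp))) → Supported (qOp δ inp binp)

  data SupportedAbs where
    supAbs : ∀ {xs x X} → Supported X → SupportedAbs (qAbs xs x X)

  supportedAbs⇒supported-body : ∀ {A} → SupportedAbs A → Supported (body A)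
  supportedAbs⇒supported-body (supAbs sX) = sX

  small-nonFresh : ∀ {X} → Supported X → ∀ s → Small (nonFresh s X)
  small-nonFresh (supVar {xs} {x}) s = small-⊆ only-x (small-singleton x)
    where
    only-x : ∀ y → T (nonFresh s (qVar xs x) y) → T (isYes (y ≟v x))
    only-x y nf = fromWitness (cong proj₂ (decidable-stable em (nonFresh⇒¬qFresh nf ∘ freshVar)))
  small-nonFresh (supOp _ _ small) s = small s

  supported-swap : ∀ {X} a b s → Supported X → Supported (X [ a ∧ b ] s)
  supported-swap {X} a b s = quasiterm-ind
    (λ X → Supported X → Supported (X [ a ∧ b ] s)) (λ A → SupportedAbs A → SupportedAbs (qSwapAbs A a b s))
    (λ _ _ _ → supVar)
    (λ { δ inp binp ih ihᴬ (supOp sup supᴬ small) →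
         supOp (liftPred-mapInput (qSwapM-map a b s) (λ i X e → ih i X e (sup i X e)))
               (liftPred-mapInput (qSwapAbsM-map a b s) (λ i A e → ihᴬ i A e (supᴬ i A e)))
               (λ t → small-nonFresh-swap {X = qOp δ inp binp} a b s (small t)) })
    (λ { _ _ _ ih (supAbs sX) → supAbs (ih sX) }) X

  nonFresh-qOp : ∀ {s y δ inp binp} → ¬ qFresh s y (qOp δ inp binp) →
                 (∃₂ λ i X → inp i ≡ just X × ¬ qFresh s y X) ⊎ (∃₂ λ i A → binp i ≡ just A × ¬ qFresh s y (body A))
  nonFresh-qOp {s} {y} {inp = inp} ¬f with em {liftPred (qFresh s y) inp}
  ... | no ¬fresh-inp = inj₁ (¬liftPred⇒∃ em ¬fresh-inp)
  ... | yes fresh-inp = inj₂ (¬liftPred⇒∃ em λ fresh-bodies →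
                               ¬f (freshOp fresh-inp λ { i (qAbs _ _ _) e → freshAbs (inj₂ (fresh-bodies i _ e)) }))

  small-nonFresh-qOp : ∀ {δ inp binp} → liftPred Supported inp → liftPred SupportedAbs binp →
                       dom inp ≺ var → dom binp ≺ var → ∀ s → Small (nonFresh s (qOp δ inp binp))
  small-nonFresh-qOp {δ} {inp} {binp} sup supᴬ small-inp small-binp s =
    small-covered (λ y → ∃ λ b → Cover b y) cover (reg Bool Cover Bool≺ pieces)
    where
    nonFreshIn : Maybe QTerm → var → Bool
    nonFreshIn nothing  _ = false
    nonFreshIn (just X)   = nonFresh s X

    Cover : Bool → var → Set
    Cover true  y = ∃ λ (d : dom inp)  → T (nonFreshIn (inp (proj₁ d)) y)
    Cover false y = ∃ λ (d : dom binp) → T (nonFreshIn (Maybe.map body (binp (proj₁ d))) y)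

    child-small : ∀ i → Small (nonFreshIn (inp i))
    child-small i with inp i in e
    ... | nothing = small-∅
    ... | just X  = small-nonFresh (sup i X e) s

    body-small : ∀ i → Small (nonFreshIn (Maybe.map body (binp i)))
    body-small i with binp i in e
    ... | nothing = small-∅
    ... | just A  = small-nonFresh (supportedAbs⇒supported-body (supᴬ i A e)) s

    pieces : ∀ b → Σ var (Cover b) ≺ var
    pieces true  = reg (dom inp) _ small-inp (child-small ∘ proj₁)
    pieces false = reg (dom binp) _ small-binp (body-small ∘ proj₁)

    cover : ∀ y → T (nonFresh s (qOp δ inp binp) y) → ∃ λ b → Cover b y
    cover y nf with nonFresh-qOp (nonFresh⇒¬qFresh nf)
    ... | inj₁ (i , X , e , ¬f) = true , (i , λ e' → nothing≢just (trans (sym e') e)) ,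
                                  subst (λ m → T (nonFreshIn m y)) (sym e) (¬qFresh⇒nonFresh ¬f)
    ... | inj₂ (i , A , e , ¬f) = false , (i , λ e' → nothing≢just (trans (sym e') e)) ,
                                  subst (λ m → T (nonFreshIn (Maybe.map body m) y)) (sym e) (¬qFresh⇒nonFresh ¬f)

  good⇒supported : ∀ {X} → qGood X → Supported X
  good⇒supported {X} = quasiterm-ind (λ X → qGood X → Supported X) (λ A → qGoodAbs A → SupportedAbs A)
    (λ _ _ _ → supVar)
    (λ { _ _ _ ih ihᴬ (goodOp g gᴬ small-inp small-binp) →
         let sup  = λ i X e → ih i X e (g i X e)
             supᴬ = λ i A e → ihᴬ i A e (gᴬ i A e)
         in supOp sup supᴬ (small-nonFresh-qOp sup supᴬ small-inp small-binp) })
    (λ { _ _ _ ih (goodAbs g) → supAbs (ih g) }) X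

  goodAbs⇒supportedAbs : ∀ {A} → qGoodAbs A → SupportedAbs A
  goodAbs⇒supportedAbs (goodAbs g) = supAbs (good⇒supported g)

  freshFor : ∀ s Xs vs → All Supported Xs → ∃ λ y → All (qFresh s y) Xs × All (y ≢_) vs
  freshFor s Xs vs sXs with small⇒∃∉ em (small-∪ (small-⋁ (map⁺ (All.map (λ sX → small-nonFresh sX s) sXs)))
                                                 (small-⋁ (map⁺ (All.universal small-singleton vs))))
  ... | y , y∉ = y , All.map ∉nonFresh⇒qFresh (map⁻ (∉-⋁ _ (y∉ ∘ Equivalence.from T-∨ ∘ inj₁))) ,
                     All.map (λ y∉v y≡v → y∉v (fromWitness y≡v)) (map⁻ (∉-⋁ _ (y∉ ∘ Equivalence.from T-∨ ∘ inj₂)))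

  alphaAbs-refl-from : ∀ {A} → (∀ a b s → let Z = body A [ a ∧ b ] s in Supported Z → alpha Z Z) →
                       SupportedAbs A → alphaAbs A A
  alphaAbs-refl-from {qAbs xs x X} refl-body (supAbs sX) = case freshFor xs (X ∷ []) (x ∷ []) (sX ∷ []) of λ where
    (w , fw ∷ [] , w≢x ∷ []) → alphaAbsI refl (w , w≢x , w≢x , fw , fw , refl-body w x xs (supported-swap w x xs sX))

  alpha-refl : ∀ {X} → Supported X → alpha X X
  alpha-refl {X} = swap-ind (λ X → Supported X → alpha X X) (λ _ _ _ → alphaVar refl refl)
    (λ { _ _ _ ih ihᴬ (supOp sup supᴬ _) →
         alphaOp refl (liftRel-diag (λ i X e → ih i X e (sup i X e)))
                      (liftRel-diag (λ i A e → alphaAbs-refl-from (ihᴬ i A e) (supᴬ i A e))) }) X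

  alphaAbs-refl : ∀ {A} → SupportedAbs A → alphaAbs A A
  alphaAbs-refl = alphaAbs-refl-from (λ _ _ _ → alpha-refl)

  qFresh-rename-binder : ∀ {s a xs x w Z} → qFreshAbs s a (qAbs xs x Z) → qFresh xs w Z → w ≢ a →
                         qFresh s a (Z [ w ∧ x ] xs)
  qFresh-rename-binder {s} {a} {xs} {x} {w} {Z} (freshAbs fa) fw w≢a = by-cases (s ≟s xs) (a ≟v x)
    where
    fresh-in-Z : (s , a) ≢ (xs , x) → qFresh s a Z
    fresh-in-Z ≢ = [ ⊥-elim ∘ ≢ , id ] fa
    by-cases : Dec (s ≡ xs) → Dec (a ≡ x) → qFresh s a (Z [ w ∧ x ] xs)
    by-cases (no s≢xs) _ = subst (λ v → qFresh s v (Z [ w ∧ x ] xs)) (swapVar-≢sort s≢xs)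
                                 (qFresh-swap Z w x xs (fresh-in-Z (s≢xs ∘ cong proj₁)))
    by-cases (yes refl) (yes refl) = subst (λ v → qFresh s v (Z [ w ∧ a ] s)) (swapVar-left s w a) (qFresh-swap Z w a s fw)
    by-cases (yes refl) (no a≢x) = subst (λ v → qFresh s v (Z [ w ∧ x ] s)) (swapVar-id (w≢a ∘ sym) a≢x)
                                         (qFresh-swap Z w x s (fresh-in-Z (a≢x ∘ cong proj₂)))

  SwapFreshAt : QTerm → Set
  SwapFreshAt X = ∀ {s a b} → Supported X → qFresh s a X → qFresh s b X → alpha (X [ a ∧ b ] s) X

  alphaAbs-swap-fresh-from : ∀ {A s a b} → (∀ a' b' s' → SwapFreshAt (body A [ a' ∧ b' ] s')) →
                             SupportedAbs A → qFreshAbs s a A → qFreshAbs s b A → alphaAbs (qSwapAbs A a b s) A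
  alphaAbs-swap-fresh-from {qAbs xs x Z} {s} {a} {b} ih (supAbs sZ) fa fb =
    case freshFor xs (Z ∷ []) (x ∷ a ∷ b ∷ swapVar s a b xs x ∷ []) (sZ ∷ []) of λ where
      (w , fw ∷ [] , w≢x ∷ w≢a ∷ w≢b ∷ w≢πx ∷ []) →
        let w-fixed = swapVar-id {s} {a} {b} {xs} w≢a w≢b
        in alphaAbsI refl (w , w≢πx , w≢x , subst (λ v → qFresh xs v (Z [ a ∧ b ] s)) w-fixed (qFresh-swap Z a b s fw) ,
                           fw ,
             alpha-resp-≋ (ih w x xs (supported-swap w x xs sZ) (qFresh-rename-binder fa fw w≢a) (qFresh-rename-binder fb fw w≢b))
                          (subst (λ v → (Z [ w ∧ x ] xs) [ a ∧ b ] s ≋ (Z [ a ∧ b ] s) [ v ∧ swapVar s a b xs x ] xs)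
                                 w-fixed (qSwap-conjugate Z s a b xs w x))
                          (≋-refl _))

  alpha-swap-fresh : ∀ {X} → SwapFreshAt X
  alpha-swap-fresh {X} = swap-ind SwapFreshAt
    (λ { _ _ _ (freshVar a≢) (freshVar b≢) → alphaVar refl (swapVar-fresh a≢ b≢) })
    (λ { _ _ _ ih ihᴬ {s} {a} {b} (supOp sup supᴬ _) (freshOp fa faᴬ) (freshOp fb fbᴬ) →
         alphaOp refl
           (liftPred⇒liftRel-mapInputs (qSwapM-map a b s) id-map id
             (λ i X e → ih i X e (sup i X e) (fa i X e) (fb i X e)))
           (liftPred⇒liftRel-mapInputs (qSwapAbsM-map a b s) id-map id
             (λ i A e → alphaAbs-swap-fresh-from (ihᴬ i A e) (supᴬ i A e) (faᴬ i A e) (fbᴬ i A e))) }) X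

  alpha-swap-witness : ∀ {X X' xs x x' y} w → y ≢ x → y ≢ x' → w ≢ x → w ≢ x' →
                       alpha (X [ y ∧ x ] xs) (X' [ y ∧ x' ] xs) →
                       alpha ((X [ w ∧ y ] xs) [ w ∧ x ] xs) ((X' [ w ∧ y ] xs) [ w ∧ x' ] xs)
  alpha-swap-witness {X} {X'} {xs} {x} {x'} {y} w y≢x y≢x' w≢x w≢x' r =
    alpha-resp-≋ (alpha-swap w y xs r) (conjugated X x y≢x w≢x) (conjugated X' x' y≢x' w≢x')
    where
    conjugated : ∀ Z z → y ≢ z → w ≢ z → (Z [ y ∧ z ] xs) [ w ∧ y ] xs ≋ (Z [ w ∧ y ] xs) [ w ∧ z ] xs
    conjugated Z z y≢z w≢z = subst₂ (λ u v → (Z [ y ∧ z ] xs) [ w ∧ y ] xs ≋ (Z [ w ∧ y ] xs) [ u ∧ v ] xs)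
      (swapVar-right xs w y) (swapVar-id (w≢z ∘ sym) (y≢z ∘ sym)) (qSwap-conjugate Z xs w y xs y z)

  TransAt : QTerm → Set
  TransAt L = Supported L → ∀ {M N} → Supported M → Supported N → alpha L M → alpha M N → alpha L N

  -- Chain through (X [ w ∧ y ]) [ w ∧ x ], which is alpha-equivalent to X [ w ∧ x ] as w and y are
  -- fresh for X, and likewise on the X' side.
  alpha-rename-witness : ∀ {L xs x X x' X'} w → alphaAbs (qAbs xs x X) (qAbs xs x' X') →
                         w ≢ x → w ≢ x' → qFresh xs w X → qFresh xs w X' →
                         TransAt L → Supported L → Supported X → Supported X' →
                         alpha L (X [ w ∧ x ] xs) → alpha L (X' [ w ∧ x' ] xs)
  alpha-rename-witness {L} {xs} {x} {X} {x'} {X'} w (alphaAbsI refl (y , y≢x , y≢x' , fy , fy' , r))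
                       w≢x w≢x' fw fw' trans-L sL sX sX' L≈X =
    let L≈Xyx   = trans-L sL (sw₁ sX) (sw₂ sX) L≈X (alpha-sym (unrenamed sX x fw fy))
        L≈X'yx' = trans-L sL (sw₂ sX) (sw₂ sX') L≈Xyx (alpha-swap-witness w y≢x y≢x' w≢x w≢x' r)
    in trans-L sL (sw₂ sX') (sw₁ sX') L≈X'yx' (unrenamed sX' x' fw' fy')
    where
    sw₁ : ∀ {Z z} → Supported Z → Supported (Z [ w ∧ z ] xs)
    sw₁ = supported-swap w _ xs
    sw₂ : ∀ {Z z} → Supported Z → Supported ((Z [ w ∧ y ] xs) [ w ∧ z ] xs)
    sw₂ = sw₁ ∘ supported-swap w y xs
    unrenamed : ∀ {Z} → Supported Z → ∀ z → qFresh xs w Z → qFresh xs y Z →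
                alpha ((Z [ w ∧ y ] xs) [ w ∧ z ] xs) (Z [ w ∧ z ] xs)
    unrenamed sZ z fw fy = alpha-swap w z xs (alpha-swap-fresh sZ fw fy)

  alphaAbs-trans-from : ∀ {A B C} → (∀ a b s → TransAt (body A [ a ∧ b ] s)) →
                        SupportedAbs A → SupportedAbs B → SupportedAbs C → alphaAbs A B → alphaAbs B C → alphaAbs A C
  alphaAbs-trans-from {qAbs xs x X} {qAbs _ x' X'} {qAbs _ x'' X''} trans-body (supAbs sX) (supAbs sX') (supAbs sX'')
                      r₁@(alphaAbsI refl _) r₂@(alphaAbsI refl _) =
    case freshFor xs (X ∷ X' ∷ X'' ∷ []) (x ∷ x' ∷ x'' ∷ []) (sX ∷ sX' ∷ sX'' ∷ []) of λ where
      (w , fw ∷ fw' ∷ fw'' ∷ [] , w≢x ∷ w≢x' ∷ w≢x'' ∷ []) →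
        let sL   = supported-swap w x xs sX
            tr   = trans-body w x xs
            L≈X' = alpha-rename-witness w r₁ w≢x w≢x' fw fw' tr sL sX sX' (alpha-refl sL)
        in alphaAbsI refl (w , w≢x , w≢x'' , fw , fw'' , alpha-rename-witness w r₂ w≢x' w≢x'' fw' fw'' tr sL sX' sX'' L≈X')

  alpha-trans : ∀ {X} → TransAt X
  alpha-trans {X} = swap-ind TransAt
    (λ { _ _ _ _ _ (alphaVar refl refl) (alphaVar refl refl) → alphaVar refl refl })
    (λ { _ _ _ ih ihᴬ (supOp sup supᴬ _) (supOp sup' supᴬ' _) (supOp sup'' supᴬ'' _)
             (alphaOp refl r rᴬ) (alphaOp refl r' rᴬ') →
         alphaOp refl
           (liftRel-trans (λ ((tr , sX) , sY , XY) (_ , sZ , YZ) → tr sX sY sZ XY YZ)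
                          (liftRel-zip (λ i X e → ih i X e , sup i X e) sup' r) (liftRel-zip sup' sup'' r'))
           (liftRel-trans (λ ((tr , sA) , sB , AB) (_ , sC , BC) → alphaAbs-trans-from tr sA sB sC AB BC)
                          (liftRel-zip (λ i A e → ihᴬ i A e , supᴬ i A e) supᴬ' rᴬ) (liftRel-zip supᴬ' supᴬ'' rᴬ')) }) X

  alphaAbs-trans : ∀ {A B C} → SupportedAbs A → SupportedAbs B → SupportedAbs C → alphaAbs A B → alphaAbs B C → alphaAbs A C
  alphaAbs-trans = alphaAbs-trans-from (λ _ _ _ → alpha-trans)

  ToAlpha'At : QTerm → Set
  ToAlpha'At X = Supported X → ∀ {Y} → Supported Y → alpha X Y → alpha' X Y

  alphaAbs⇒alphaAbs'-from : ∀ {A B} → (∀ a b s → ToAlpha'At (body A [ a ∧ b ] s)) →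
                            SupportedAbs A → SupportedAbs B → alphaAbs A B → alphaAbs' A B
  alphaAbs⇒alphaAbs'-from {qAbs xs x X} {qAbs _ x' X'} to-alpha' (supAbs sX) (supAbs sX') r@(alphaAbsI refl _) =
    alphaAbs'I refl λ w w≢x w≢x' fw fw' →
      let sL = supported-swap w x xs sX
      in to-alpha' w x xs sL (supported-swap w x' xs sX')
                   (alpha-rename-witness w r w≢x w≢x' fw fw' alpha-trans sL sX sX' (alpha-refl sL))

  alpha⇒alpha' : ∀ {X} → ToAlpha'At X
  alpha⇒alpha' {X} = swap-ind ToAlpha'At
    (λ { _ _ _ _ (alphaVar refl refl) → alpha'Var refl refl })
    (λ { _ _ _ ih ihᴬ (supOp sup supᴬ _) (supOp sup' supᴬ' _) (alphaOp refl r rᴬ) →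
         alpha'Op refl
           (liftRel-map (λ ((to , sX) , sY , XY) → to sX sY XY) (liftRel-zip (λ i X e → ih i X e , sup i X e) sup' r))
           (liftRel-map (λ ((to , sA) , sB , AB) → alphaAbs⇒alphaAbs'-from to sA sB AB)
                        (liftRel-zip (λ i A e → ihᴬ i A e , supᴬ i A e) supᴬ' rᴬ)) }) X

  alphaAbs⇒alphaAbs' : ∀ {A B} → SupportedAbs A → SupportedAbs B → alphaAbs A B → alphaAbs' A B
  alphaAbs⇒alphaAbs' = alphaAbs⇒alphaAbs'-from (λ _ _ _ → alpha⇒alpha')

  alphaAbs'⇒alphaAbs-from : ∀ {xs x X x' X'} →
    (∀ y → y ≢ x → y ≢ x' → qFresh xs y X → qFresh xs y X' →
       Supported (X [ y ∧ x ] xs) → Supported (X' [ y ∧ x' ] xs) → alpha (X [ y ∧ x ] xs) (X' [ y ∧ x' ] xs)) →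
    SupportedAbs (qAbs xs x X) → SupportedAbs (qAbs xs x' X') → alphaAbs (qAbs xs x X) (qAbs xs x' X')
  alphaAbs'⇒alphaAbs-from {xs} {x} {X} {x'} {X'} to-alpha (supAbs sX) (supAbs sX') =
    case freshFor xs (X ∷ X' ∷ []) (x ∷ x' ∷ []) (sX ∷ sX' ∷ []) of λ where
      (w , fw ∷ fw' ∷ [] , w≢x ∷ w≢x' ∷ []) →
        alphaAbsI refl (w , w≢x , w≢x' , fw , fw' ,
                        to-alpha w w≢x w≢x' fw fw' (supported-swap w x xs sX) (supported-swap w x' xs sX'))

  alpha'⇒alpha : ∀ {X Y} → alpha' X Y → Supported X → Supported Y → alpha X Y
  alpha'⇒alpha r = Alpha'Induction.alpha'-ind
    (λ X Y → Supported X → Supported Y → alpha X Y) (λ A B → SupportedAbs A → SupportedAbs B → alphaAbs A B)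
    (λ _ _ _ _ → alphaVar refl refl)
    (λ { _ _ _ _ _ r rᴬ (supOp sup supᴬ _) (supOp sup' supᴬ' _) →
         alphaOp refl (liftRel-map (λ (sX , sY , h) → h sX sY) (liftRel-zip sup sup' r))
                      (liftRel-map (λ (sA , sB , h) → h sA sB) (liftRel-zip supᴬ supᴬ' rᴬ)) })
    (λ _ _ _ _ _ → alphaAbs'⇒alphaAbs-from)
    r

  alphaAbs'⇒alphaAbs : ∀ {A B} → alphaAbs' A B → SupportedAbs A → SupportedAbs B → alphaAbs A B
  alphaAbs'⇒alphaAbs (alphaAbs'I refl h) =
    alphaAbs'⇒alphaAbs-from λ y y≢x y≢x' f f' → alpha'⇒alpha (h y y≢x y≢x' f f')

proposition2 : (var varsort opsym index bindex : Set)
               (_≟v_ : DecidableEquality var) (_≟s_ : DecidableEquality varsort) →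
               ExcludedMiddle 0ℓ →
               Infinite var → Regular var →
               let open Terms var varsort opsym index bindex _≟v_ _≟s_ in
               (IsEquivalence {A = Σ QTerm qGood} (λ X Y → alpha (proj₁ X) (proj₁ Y)) ×
                IsEquivalence {A = Σ QAbs qGoodAbs} (λ A B → alphaAbs (proj₁ A) (proj₁ B))) ×
               ((X X' : QTerm) → qGood X → qGood X' → (alpha' X X' ⇔ alpha X X')) ×
               ((A A' : QAbs) → qGoodAbs A → qGoodAbs A' → (alphaAbs' A A' ⇔ alphaAbs A A'))
proposition2 var varsort opsym index bindex _≟v_ _≟s_ em inf reg =
  (alpha-isEquivalence , alphaAbs-isEquivalence) , alpha'⇔alpha , alphaAbs'⇔alphaAbs
  where
  open Terms var varsort opsym index bindex _≟v_ _≟s_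
  open Quasiterms var varsort opsym index bindex _≟v_ _≟s_
  open AlphaOnGood var varsort opsym index bindex _≟v_ _≟s_ em inf reg

  alpha-isEquivalence : IsEquivalence {A = Σ QTerm qGood} (λ X Y → alpha (proj₁ X) (proj₁ Y))
  alpha-isEquivalence = record
    { refl  = λ {X} → alpha-refl (good⇒supported (proj₂ X))
    ; sym   = alpha-sym
    ; trans = λ {X} {Y} {Z} → alpha-trans (good⇒supported (proj₂ X)) (good⇒supported (proj₂ Y)) (good⇒supported (proj₂ Z))
    }

  alphaAbs-isEquivalence : IsEquivalence {A = Σ QAbs qGoodAbs} (λ A B → alphaAbs (proj₁ A) (proj₁ B))
  alphaAbs-isEquivalence = record
    { refl  = λ {A} → alphaAbs-refl (goodAbs⇒supportedAbs (proj₂ A))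
    ; sym   = alphaAbs-sym
    ; trans = λ {A} {B} {C} → alphaAbs-trans (goodAbs⇒supportedAbs (proj₂ A)) (goodAbs⇒supportedAbs (proj₂ B))
                                             (goodAbs⇒supportedAbs (proj₂ C))
    }

  alpha'⇔alpha : (X X' : QTerm) → qGood X → qGood X' → (alpha' X X' ⇔ alpha X X')
  alpha'⇔alpha X X' g g' = mk⇔ (λ r → alpha'⇒alpha r (good⇒supported g) (good⇒supported g'))
                               (alpha⇒alpha' (good⇒supported g) (good⇒supported g'))

  alphaAbs'⇔alphaAbs : (A A' : QAbs) → qGoodAbs A → qGoodAbs A' → (alphaAbs' A A' ⇔ alphaAbs A A')
  alphaAbs'⇔alphaAbs A A' g g' = mk⇔ (λ r → alphaAbs'⇒alphaAbs r (goodAbs⇒supportedAbs g) (goodAbs⇒supportedAbs g'))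
                                     (alphaAbs⇒alphaAbs' (goodAbs⇒supportedAbs g) (goodAbs⇒supportedAbs g'))
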